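{- Let $\Omega$ be a system of $\ell$ equations in the variables $u_1,\dots,u_m,v$: $$\sum_{j=1}^m c_{i,j}\,u_j=b_i\,v,\qquad i=1,\dots,\ell,$$ where the $c_{i,j}$ and $b_i$ are non-negative integers such that for each $i\in[1,\ell]$ at least two of $c_{i,1},\dots,c_{i,m}$ are nonzero and $\sum_{j=1}^m c_{i,j}=b_i>0$. Let $D=\max_{1\le i\le\ell}b_i$, let $q$ be an integer with $q>D$, pick an integer $n>0$ with $nD<q$, and let $k=\lfloor \log q/\log(nD+1)\rfloor$. Then there exists a set $S\subseteq[0,q-1]$ with $$|S|\ge\frac{(n+1)^{k-2}-1}{k}$$ such that $S$ contains no proper solution over $\mathbb{Z}_q$ to any of the equations in $\Omega$.
   Context: For integers $a\le b$, $[a,b]=\{x\in\mathbb{Z}: a\le x\le b\}$; $\log$ is the natural logarithm. A set $S\subseteq[0,q-1]$ contains a proper solution over $\mathbb{Z}_q$ to the equation $\sum_{j=1}^m c_{i,j}u_j=b_iv$ if there exist pairwise distinct $u_1,\dots,u_m,v\in S$ with $\sum_{j=1}^m c_{i,j}u_j\equiv b_iv\pmod q$. -}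

module Defs where

open import Data.Nat using (ℕ; zero; suc; _+_; _*_; _⊔_; _<_; _≤_; _∸_; _^_)
open import Data.Fin using (Fin)
open import Data.Vec.Functional using (foldr)
open import Data.Integer as ℤ using (ℤ; +_)
open import Data.Integer.Divisibility using (_∣_)
open import Data.List using (List; length)
open import Data.List.Membership.Propositional using (_∈_)
open import Data.List.Relation.Unary.All using (All)
open import Data.List.Relation.Unary.Unique.Propositional using (Unique)
open import Data.Product using (Σ; _×_; ∃; ∃-syntax)
open import Relation.Binary.PropositionalEquality using (_≡_; _≢_)

sumF : ∀ {m} → (Fin m → ℕ) → ℕ
sumF = foldr _+_ 0

maxF : ∀ {m} → (Fin m → ℕ) → ℕ
maxF = foldr _⊔_ 0

_≡_[mod_] : ℕ → ℕ → ℕ → Set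
a ≡ b [mod q ] = (+ q) ∣ ((+ a) ℤ.- (+ b))

ProperSolution : (q : ℕ) {m : ℕ} (c : Fin m → ℕ) (b : ℕ) (S : List ℕ) → Set
ProperSolution q {m} c b S =
  Σ (Fin m → ℕ) λ u → Σ ℕ λ v →
    (∀ j → u j ∈ S) × (v ∈ S) ×
    (∀ j j' → j ≢ j' → u j ≢ u j') × (∀ j → u j ≢ v) ×
    (sumF (λ j → c j * u j) ≡ b * v [mod q ])

-- S ⊆ [0, q-1] given as a duplicate-free list; |S| = length S
SubsetOfRange : ℕ → List ℕ → Set
SubsetOfRange q S = Unique S × All (_< q) S

module Submission where

-- Write N < (n+1)^K, K = k - 2, in base n+1 and read its digits x_t in base d = nD + 1 to get φ(N);
-- with weights summing to at most D no carries occur, so a relation Σ c_j φ(N_j) = b φ(M) holds digit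
-- by digit.  Split the digit square sum σ(N) = r + W i with W = n² + 1, r < W, i ≤ K, keep the largest
-- class of a fixed i (pigeonhole), and append r as an extra lowest digit in base d².  A solution in that
-- class then also satisfies Σ c_j σ(N_j) = b σ(M), and as Σ c_j x_j² - b y² = Σ c_j (x_j - y)² whenever
-- Σ c_j x_j = b y, every N_j with c_j ≠ 0 has the digits of M.  Both sides of the equation stay below
-- d^k ≤ q, so the congruence mod q is an equality.

open import Defs
open import Data.Empty using (⊥-elim)
open import Data.Fin using (Fin; zero; suc)
import Data.Integer as ℤ
import Data.Integer.Properties as ℤ
open import Data.List using (List; []; _∷_; length; map; filter; upTo)
open import Data.List.Properties using (filter-accept; filter-reject; length-map; length-upTo)
open import Data.List.Relation.Unary.All as All using (All; []; _∷_)
open import Data.List.Relation.Unary.AllPairs using ([]; _∷_)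
open import Data.List.Relation.Unary.Unique.Propositional using (Unique)
open import Data.List.Relation.Unary.Unique.Propositional.Properties using (upTo⁺; filter⁺)
open import Data.List.Membership.Propositional using (_∈_)
open import Data.List.Membership.Propositional.Properties using (∈-map⁻; ∈-filter⁻; ∈-upTo⁻)
open import Data.List.Relation.Unary.Any using (here; there)
open import Data.Nat
open import Data.Nat.Divisibility using (>⇒∤) renaming (_∣_ to _∣ℕ_)
open import Data.Nat.DivMod using (m%n<n; m≡m%n+[m/n]*n; m<n*o⇒m/o<n)
open import Data.Nat.Properties
open import Data.Nat.Tactic.RingSolver using (solve-∀)
open import Data.Product using (Σ; _×_; _,_; proj₁; proj₂; ∃-syntax)
open import Data.Sum using (inj₁; inj₂; reduce)
open import Function using (_∘_)
open import Relation.Binary.Definitions using (tri<; tri≈; tri>)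
open import Relation.Binary.PropositionalEquality
open import Relation.Nullary using (¬_; yes; no; contradiction)

scale-digits : ∀ b a R e → b * (a + R * e) ≡ b * a + R * (b * e)
scale-digits = solve-∀

sumF-cong : ∀ {m} (f g : Fin m → ℕ) → (∀ j → f j ≡ g j) → sumF f ≡ sumF g
sumF-cong {zero}  f g f≗g = refl
sumF-cong {suc m} f g f≗g = cong₂ _+_ (f≗g zero) (sumF-cong (f ∘ suc) (g ∘ suc) (f≗g ∘ suc))

sumF-+ : ∀ {m} (f g : Fin m → ℕ) → sumF (λ j → f j + g j) ≡ sumF f + sumF g
sumF-+ {zero}  f g = refl
sumF-+ {suc m} f g = begin
  f zero + g zero + sumF (λ j → f (suc j) + g (suc j))
    ≡⟨ cong (f zero + g zero +_) (sumF-+ (f ∘ suc) (g ∘ suc)) ⟩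
  f zero + g zero + (sumF (f ∘ suc) + sumF (g ∘ suc))
    ≡⟨ +-+-interchange (f zero) (g zero) _ _ ⟩
  f zero + sumF (f ∘ suc) + (g zero + sumF (g ∘ suc)) ∎
  where
  open ≡-Reasoning
  +-+-interchange : ∀ a b c d → a + b + (c + d) ≡ a + c + (b + d)
  +-+-interchange = solve-∀

sumF-*ʳ : ∀ {m} k (f : Fin m → ℕ) → sumF (λ j → f j * k) ≡ sumF f * k
sumF-*ʳ {zero}  k f = refl
sumF-*ʳ {suc m} k f =
  trans (cong (f zero * k +_) (sumF-*ʳ k (f ∘ suc))) (sym (*-distribʳ-+ k (f zero) _))

sumF-mono-≤ : ∀ {m} (f g : Fin m → ℕ) → (∀ j → f j ≤ g j) → sumF f ≤ sumF g
sumF-mono-≤ {zero}  f g f≤g = z≤n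
sumF-mono-≤ {suc m} f g f≤g = +-mono-≤ (f≤g zero) (sumF-mono-≤ (f ∘ suc) (g ∘ suc) (f≤g ∘ suc))

≤-sumF : ∀ {m} (f : Fin m → ℕ) j → f j ≤ sumF f
≤-sumF f zero    = m≤m+n (f zero) _
≤-sumF f (suc j) = ≤-trans (≤-sumF (f ∘ suc) j) (m≤n+m _ (f zero))

sumF≡0⇒≡0 : ∀ {m} (f : Fin m → ℕ) → sumF f ≡ 0 → ∀ j → f j ≡ 0
sumF≡0⇒≡0 f Σf≡0 j = n≤0⇒n≡0 (subst (f j ≤_) Σf≡0 (≤-sumF f j))

≤-maxF : ∀ {m} (f : Fin m → ℕ) j → f j ≤ maxF f
≤-maxF f zero    = m≤m⊔n (f zero) _
≤-maxF f (suc j) = ≤-trans (≤-maxF (f ∘ suc) j) (m≤n⊔m (f zero) _)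

sumF-*-≤ : ∀ {m} (c g : Fin m → ℕ) {G} → (∀ j → g j ≤ G) → sumF (λ j → c j * g j) ≤ sumF c * G
sumF-*-≤ c g {G} g≤G = ≤-trans
  (sumF-mono-≤ (λ j → c j * g j) (λ j → c j * G) (λ j → *-monoʳ-≤ (c j) (g≤G j)))
  (≤-reflexive (sumF-*ʳ G c))

sumF-*-+-* : ∀ {m} (c a e : Fin m → ℕ) R →
  sumF (λ j → c j * (a j + R * e j)) ≡ sumF (λ j → c j * a j) + R * sumF (λ j → c j * e j)
sumF-*-+-* {zero}  c a e R = sym (*-zeroʳ R)
sumF-*-+-* {suc m} c a e R = begin
  c zero * (a zero + R * e zero) + sumF (λ j → c (suc j) * (a (suc j) + R * e (suc j)))
    ≡⟨ cong₂ _+_ (scale-digits (c zero) (a zero) R (e zero)) (sumF-*-+-* (c ∘ suc) (a ∘ suc) (e ∘ suc) R) ⟩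
  (c zero * a zero + R * (c zero * e zero)) + (A + R * E)
    ≡⟨ regroup (c zero * a zero) (c zero * e zero) A E R ⟩
  (c zero * a zero + A) + R * (c zero * e zero + E) ∎
  where
  open ≡-Reasoning
  A = sumF (λ j → c (suc j) * a (suc j))
  E = sumF (λ j → c (suc j) * e (suc j))
  regroup : ∀ x y A E R → (x + R * y) + (A + R * E) ≡ (x + A) + R * (y + E)
  regroup = solve-∀

+-*-< : ∀ {a R e E} → a < R → e < E → a + R * e < R * E
+-*-< {a} {R} {e} {E} a<R e<E = begin-strict
  a + R * e   <⟨ +-monoˡ-< (R * e) a<R ⟩
  R + R * e   ≡⟨ *-suc R e ⟨
  R * suc e   ≤⟨ *-monoʳ-≤ R e<E ⟩
  R * E       ∎
  where open ≤-Reasoning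

*-+-*-< : ∀ {b a R e E} → b * a < R → b * e < E → b * (a + R * e) < R * E
*-+-*-< {b} {a} {R} {e} {E} ba<R be<E =
  subst (_< R * E) (sym (scale-digits b a R e)) (+-*-< ba<R be<E)

+-*-<-+-* : ∀ {R a a' e e'} → a < R → e < e' → a + R * e < a' + R * e'
+-*-<-+-* {a' = a'} a<R e<e' = ≤-trans (+-*-< a<R e<e') (m≤n+m _ a')

+-*-injective : ∀ {R a a' e e'} → a < R → a' < R → a + R * e ≡ a' + R * e' → a ≡ a' × e ≡ e'
+-*-injective {R} {a} {a'} {e} {e'} a<R a'<R eq with <-cmp e e'
... | tri< e<e' _ _ = ⊥-elim (<-irrefl eq (+-*-<-+-* a<R e<e'))
... | tri≈ _ refl _ = +-cancelʳ-≡ (R * e) a a' eq , refl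
... | tri> _ _ e'<e = ⊥-elim (<-irrefl (sym eq) (+-*-<-+-* a'<R e'<e))

sumF-digit-split : ∀ {m} (c a e : Fin m → ℕ) {b A R a' e'} → sumF c ≡ b →
  (∀ j → a j ≤ A) → a' ≤ A → b * A < R →
  sumF (λ j → c j * (a j + R * e j)) ≡ b * (a' + R * e') →
  sumF (λ j → c j * a j) ≡ b * a' × sumF (λ j → c j * e j) ≡ b * e'
sumF-digit-split c a e {b} {A} {R} {a'} {e'} Σc≡b a≤A a'≤A bA<R eq =
  +-*-injective Σca<R ba'<R (begin
    sumF (λ j → c j * a j) + R * sumF (λ j → c j * e j) ≡⟨ sumF-*-+-* c a e R ⟨
    sumF (λ j → c j * (a j + R * e j))                 ≡⟨ eq ⟩
    b * (a' + R * e')                                  ≡⟨ scale-digits b a' R e' ⟩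
    b * a' + R * (b * e')                              ∎)
  where
  open ≡-Reasoning
  Σca<R : sumF (λ j → c j * a j) < R
  Σca<R = ≤-<-trans (subst (λ s → sumF (λ j → c j * a j) ≤ s * A) Σc≡b (sumF-*-≤ c a a≤A)) bA<R
  ba'<R : b * a' < R
  ba'<R = ≤-<-trans (*-monoʳ-≤ b a'≤A) bA<R

sq-+-sq-≤ : ∀ {x y} → x ≤ y → x * x + y * y ≡ ∣ x - y ∣ * ∣ x - y ∣ + 2 * (x * y)
sq-+-sq-≤ {x} {y} x≤y =
  subst (λ y → x * x + y * y ≡ ∣ x - y ∣ * ∣ x - y ∣ + 2 * (x * y)) (m+[n∸m]≡n x≤y) (shifted (y ∸ x))
  where
  expand : ∀ x t → x * x + (x + t) * (x + t) ≡ t * t + 2 * (x * (x + t))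
  expand = solve-∀
  shifted : ∀ t → x * x + (x + t) * (x + t) ≡ ∣ x - x + t ∣ * ∣ x - x + t ∣ + 2 * (x * (x + t))
  shifted t rewrite ∣m-m+n∣≡n x t = expand x t

sq-+-sq : ∀ x y → x * x + y * y ≡ ∣ x - y ∣ * ∣ x - y ∣ + 2 * (x * y)
sq-+-sq x y with ≤-total x y
... | inj₁ x≤y = sq-+-sq-≤ x≤y
... | inj₂ y≤x = begin
  x * x + y * y                       ≡⟨ +-comm (x * x) (y * y) ⟩
  y * y + x * x                       ≡⟨ sq-+-sq-≤ y≤x ⟩
  ∣ y - x ∣ * ∣ y - x ∣ + 2 * (y * x) ≡⟨ cong₂ (λ s t → s * s + 2 * t) (∣-∣-comm y x) (*-comm y x) ⟩
  ∣ x - y ∣ * ∣ x - y ∣ + 2 * (x * y) ∎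
  where open ≡-Reasoning

sqDeviation : ∀ {m} → (Fin m → ℕ) → (Fin m → ℕ) → ℕ → ℕ
sqDeviation c x y = sumF (λ j → c j * (∣ x j - y ∣ * ∣ x j - y ∣))

sumF-sq-decomposition : ∀ {m} (c x : Fin m → ℕ) {b} y → sumF c ≡ b → sumF (λ j → c j * x j) ≡ b * y →
  sumF (λ j → c j * (x j * x j)) ≡ sqDeviation c x y + b * (y * y)
sumF-sq-decomposition {m} c x {b} y Σc≡b Σcx≡by = +-cancelʳ-≡ (b * (y * y)) _ _ (begin
  Σcx² + b * (y * y)
    ≡⟨ cong (λ s → Σcx² + s * (y * y)) Σc≡b ⟨
  Σcx² + sumF c * (y * y)
    ≡⟨ cong (Σcx² +_) (sumF-*ʳ (y * y) c) ⟨
  Σcx² + sumF (λ j → c j * (y * y))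
    ≡⟨ sumF-+ (λ j → c j * (x j * x j)) (λ j → c j * (y * y)) ⟨
  sumF (λ j → c j * (x j * x j) + c j * (y * y))
    ≡⟨ sumF-cong _ _ (λ j → pointwise (c j) (x j)) ⟩
  sumF (λ j → dev j + c j * x j * (2 * y))
    ≡⟨ sumF-+ dev (λ j → c j * x j * (2 * y)) ⟩
  sqDeviation c x y + sumF (λ j → c j * x j * (2 * y))
    ≡⟨ cong (sqDeviation c x y +_) (sumF-*ʳ (2 * y) (λ j → c j * x j)) ⟩
  sqDeviation c x y + sumF (λ j → c j * x j) * (2 * y)
    ≡⟨ cong (λ s → sqDeviation c x y + s * (2 * y)) Σcx≡by ⟩
  sqDeviation c x y + b * y * (2 * y)
    ≡⟨ twice (sqDeviation c x y) b y ⟩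
  sqDeviation c x y + b * (y * y) + b * (y * y) ∎)
  where
  open ≡-Reasoning
  Σcx² : ℕ
  Σcx² = sumF (λ j → c j * (x j * x j))
  dev : Fin m → ℕ
  dev j = c j * (∣ x j - y ∣ * ∣ x j - y ∣)
  rearrange : ∀ c s x y → c * (s + 2 * (x * y)) ≡ c * s + c * x * (2 * y)
  rearrange = solve-∀
  pointwise : ∀ cj xj → cj * (xj * xj) + cj * (y * y) ≡ cj * (∣ xj - y ∣ * ∣ xj - y ∣) + cj * xj * (2 * y)
  pointwise cj xj = begin
    cj * (xj * xj) + cj * (y * y)       ≡⟨ *-distribˡ-+ cj (xj * xj) (y * y) ⟨
    cj * (xj * xj + y * y)              ≡⟨ cong (cj *_) (sq-+-sq xj y) ⟩
    cj * (∣ xj - y ∣ * ∣ xj - y ∣ + 2 * (xj * y)) ≡⟨ rearrange cj (∣ xj - y ∣ * ∣ xj - y ∣) xj y ⟩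
    cj * (∣ xj - y ∣ * ∣ xj - y ∣) + cj * xj * (2 * y) ∎
  twice : ∀ D b y → D + b * y * (2 * y) ≡ D + b * (y * y) + b * (y * y)
  twice = solve-∀

sqDeviation≡0⇒≡ : ∀ {m} (c x : Fin m → ℕ) y → sqDeviation c x y ≡ 0 → ∀ j → c j ≢ 0 → x j ≡ y
sqDeviation≡0⇒≡ c x y dev≡0 j cj≢0
  with m*n≡0⇒m≡0∨n≡0 (c j) (sumF≡0⇒≡0 (λ j → c j * (∣ x j - y ∣ * ∣ x j - y ∣)) dev≡0 j)
... | inj₁ cj≡0 = contradiction cj≡0 cj≢0
... | inj₂ sq≡0 = ∣m-n∣≡0⇒m≡n (reduce (m*n≡0⇒m≡0∨n≡0 _ sq≡0))

∣∧<⇒≡0 : ∀ {q x} → q ∣ℕ x → x < q → x ≡ 0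
∣∧<⇒≡0 {x = zero}  _   _   = refl
∣∧<⇒≡0 {x = suc _} q∣x x<q = contradiction q∣x (>⇒∤ x<q)

∣⊖∣< : ∀ {q A B} → A < q → B < q → ℤ.∣ A ℤ.⊖ B ∣ < q
∣⊖∣< {q} {A} {B} A<q B<q with ≤-total A B
... | inj₁ A≤B = ≤-<-trans (≤-reflexive (ℤ.∣⊖∣-≤ A≤B)) (≤-<-trans (m∸n≤m B A) B<q)
... | inj₂ B≤A = ≤-<-trans (≤-reflexive (trans (ℤ.∣m⊖n∣≡∣n⊖m∣ A B) (ℤ.∣⊖∣-≤ B≤A)))
                           (≤-<-trans (m∸n≤m A B) A<q)

≡[mod]⇒≡ : ∀ {q A B} → A ≡ B [mod q ] → A < q → B < q → A ≡ B
≡[mod]⇒≡ {q} {A} {B} q∣A-B A<q B<q =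
  ℤ.+-injective (ℤ.i-j≡0⇒i≡j (ℤ.+ A) (ℤ.+ B) (ℤ.∣i∣≡0⇒i≡0 (∣∧<⇒≡0 q∣A-B ∣A-B∣<q)))
  where
  ∣A-B∣<q : ℤ.∣ ℤ.+ A ℤ.- ℤ.+ B ∣ < q
  ∣A-B∣<q = subst (_< q) (cong ℤ.∣_∣ (sym (ℤ.m-n≡m⊖n A B))) (∣⊖∣< A<q B<q)

sumBelow : ℕ → (ℕ → ℕ) → ℕ
sumBelow zero    h = 0
sumBelow (suc B) h = h B + sumBelow B h

sumBelow-mono-≤ : ∀ B (f h : ℕ → ℕ) → (∀ i → f i ≤ h i) → sumBelow B f ≤ sumBelow B h
sumBelow-mono-≤ zero    f h f≤h = z≤n
sumBelow-mono-≤ (suc B) f h f≤h = +-mono-≤ (f≤h B) (sumBelow-mono-≤ B f h f≤h)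

sumBelow≤*some : ∀ B (h : ℕ → ℕ) → ∃[ i ] sumBelow B h ≤ B * h i
sumBelow≤*some zero    h = 0 , z≤n
sumBelow≤*some (suc B) h with sumBelow≤*some B h
... | i , Σh≤Bhi with ≤-total (h B) (h i)
...   | inj₁ hB≤hi = i , +-mono-≤ hB≤hi Σh≤Bhi
...   | inj₂ hi≤hB = B , +-mono-≤ ≤-refl (≤-trans Σh≤Bhi (*-monoʳ-≤ B hi≤hB))

module _ {a} {A : Set a} (g : A → ℕ) where

  fibre : ℕ → List A → List A
  fibre i = filter (λ x → g x ≟ i)

  fibre-∷-≥ : ∀ i x xs → length (fibre i xs) ≤ length (fibre i (x ∷ xs))
  fibre-∷-≥ i x xs with g x ≟ i
  ... | yes gx≡i rewrite filter-accept (λ x → g x ≟ i) {x} {xs} gx≡i = n≤1+n _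
  ... | no  gx≢i rewrite filter-reject (λ x → g x ≟ i) {x} {xs} gx≢i = ≤-refl

  sumBelow-fibres-∷ : ∀ B x xs → g x < B →
    suc (sumBelow B (λ i → length (fibre i xs))) ≤ sumBelow B (λ i → length (fibre i (x ∷ xs)))
  sumBelow-fibres-∷ (suc B) x xs gx<1+B with g x ≟ B
  ... | yes gx≡B rewrite filter-accept (λ x → g x ≟ B) {x} {xs} gx≡B =
    s≤s (+-monoʳ-≤ _ (sumBelow-mono-≤ B _ _ (λ i → fibre-∷-≥ i x xs)))
  ... | no gx≢B = ≤-trans (≤-reflexive (sym (+-suc _ _))) (+-mono-≤ (fibre-∷-≥ B x xs)
    (sumBelow-fibres-∷ B x xs (≤∧≢⇒< (s≤s⁻¹ gx<1+B) gx≢B)))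

  length≤sumBelow-fibres : ∀ B xs → All (λ x → g x < B) xs →
    length xs ≤ sumBelow B (λ i → length (fibre i xs))
  length≤sumBelow-fibres B []       []          = z≤n
  length≤sumBelow-fibres B (x ∷ xs) (gx<B ∷ gxs<B) =
    ≤-trans (s≤s (length≤sumBelow-fibres B xs gxs<B)) (sumBelow-fibres-∷ B x xs gx<B)

  pigeonhole : ∀ B xs → All (λ x → g x < B) xs → ∃[ i ] length xs ≤ B * length (fibre i xs)
  pigeonhole B xs g<B with sumBelow≤*some B (λ i → length (fibre i xs))
  ... | i , Σ≤B*fibre = i , ≤-trans (length≤sumBelow-fibres B xs g<B) Σ≤B*fibre

Unique-map⁺-on : ∀ {a b} {A : Set a} {B : Set b} (f : A → B) {xs : List A} →
  (∀ {x y} → x ∈ xs → y ∈ xs → f x ≡ f y → x ≡ y) → Unique xs → Unique (map f xs)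
Unique-map⁺-on f          f-inj []           = []
Unique-map⁺-on f {x ∷ xs} f-inj (x∉xs ∷ xs!) =
  All.tabulate (λ fy∈ fx≡fy → let (y , y∈ , fy≡) = ∈-map⁻ f fy∈ in
    All.lookup x∉xs y∈ (f-inj (here refl) (there y∈) (trans fx≡fy fy≡)))
  ∷ Unique-map⁺-on f (λ x∈ y∈ → f-inj (there x∈) (there y∈)) xs!

module Digits (n d : ℕ) where

  lastDigit : ℕ → ℕ
  lastDigit N = N % suc n

  dropDigit : ℕ → ℕ
  dropDigit N = N / suc n

  rebase : ℕ → ℕ → ℕ
  rebase zero    N = 0
  rebase (suc K) N = lastDigit N + d * rebase K (dropDigit N)

  digitSqSum : ℕ → ℕ → ℕ
  digitSqSum zero    N = 0
  digitSqSum (suc K) N = lastDigit N * lastDigit N + digitSqSum K (dropDigit N)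

  rebaseMax : ℕ → ℕ
  rebaseMax zero    = 0
  rebaseMax (suc K) = n + d * rebaseMax K

  lastDigit≤ : ∀ N → lastDigit N ≤ n
  lastDigit≤ N = s≤s⁻¹ (m%n<n N (suc n))

  rebase≤rebaseMax : ∀ K N → rebase K N ≤ rebaseMax K
  rebase≤rebaseMax zero    N = z≤n
  rebase≤rebaseMax (suc K) N =
    +-mono-≤ (lastDigit≤ N) (*-monoʳ-≤ d (rebase≤rebaseMax K (dropDigit N)))

  *-rebaseMax< : ∀ {b} → b * n < d → ∀ K → b * rebaseMax K < d ^ K
  *-rebaseMax< {b} bn<d zero    = s≤s (≤-reflexive (*-zeroʳ b))
  *-rebaseMax< {b} bn<d (suc K) = *-+-*-< {b} bn<d (*-rebaseMax< {b} bn<d K)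

  digitSqSum≤ : ∀ K N → digitSqSum K N ≤ K * (n * n)
  digitSqSum≤ zero    N = z≤n
  digitSqSum≤ (suc K) N =
    +-mono-≤ (*-mono-≤ (lastDigit≤ N) (lastDigit≤ N)) (digitSqSum≤ K (dropDigit N))

  rebase-injective : n < d → ∀ K {N N'} → N < suc n ^ K → N' < suc n ^ K →
    rebase K N ≡ rebase K N' → N ≡ N'
  rebase-injective n<d zero    N<1 N'<1 _ = trans (n<1⇒n≡0 N<1) (sym (n<1⇒n≡0 N'<1))
  rebase-injective n<d (suc K) {N} {N'} N<pᴷ⁺¹ N'<pᴷ⁺¹ eq = begin
    N                                   ≡⟨ m≡m%n+[m/n]*n N (suc n) ⟩
    lastDigit N + dropDigit N * suc n   ≡⟨ cong₂ (λ x y → x + y * suc n) same-last same-rest ⟩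
    lastDigit N' + dropDigit N' * suc n ≡⟨ m≡m%n+[m/n]*n N' (suc n) ⟨
    N'                                  ∎
    where
    open ≡-Reasoning
    digit< : ∀ M → lastDigit M < d
    digit< M = ≤-<-trans (lastDigit≤ M) n<d
    dropDigit< : ∀ {M} → M < suc n ^ suc K → dropDigit M < suc n ^ K
    dropDigit< {M} M< = m<n*o⇒m/o<n (subst (M <_) (*-comm (suc n) _) M<)
    split : lastDigit N ≡ lastDigit N' × rebase K (dropDigit N) ≡ rebase K (dropDigit N')
    split = +-*-injective (digit< N) (digit< N') eq
    same-last : lastDigit N ≡ lastDigit N'
    same-last = proj₁ split
    same-rest : dropDigit N ≡ dropDigit N'
    same-rest = rebase-injective n<d K (dropDigit< N<pᴷ⁺¹) (dropDigit< N'<pᴷ⁺¹) (proj₂ split)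

  deviation : ∀ {m} → ℕ → (Fin m → ℕ) → (Fin m → ℕ) → ℕ → ℕ
  deviation zero    c N M = 0
  deviation (suc K) c N M =
    sqDeviation c (lastDigit ∘ N) (lastDigit M) + deviation K c (dropDigit ∘ N) (dropDigit M)

  deviation≡0⇒rebase≡ : ∀ {m} K (c N : Fin m → ℕ) M → deviation K c N M ≡ 0 →
    ∀ j → c j ≢ 0 → rebase K (N j) ≡ rebase K M
  deviation≡0⇒rebase≡ zero    c N M _      j _     = refl
  deviation≡0⇒rebase≡ (suc K) c N M dev≡0 j cj≢0 = cong₂ (λ x y → x + d * y)
    (sqDeviation≡0⇒≡ c (lastDigit ∘ N) (lastDigit M) (m+n≡0⇒m≡0 _ dev≡0) j cj≢0)
    (deviation≡0⇒rebase≡ K c (dropDigit ∘ N) (dropDigit M) (m+n≡0⇒n≡0 _ dev≡0) j cj≢0)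

  digitSqSum-balance : ∀ {m} (c : Fin m → ℕ) {b} → sumF c ≡ b → b * n < d →
    ∀ K (N : Fin m → ℕ) M → sumF (λ j → c j * rebase K (N j)) ≡ b * rebase K M →
    sumF (λ j → c j * digitSqSum K (N j)) ≡ deviation K c N M + b * digitSqSum K M
  digitSqSum-balance c {b} Σc≡b bn<d zero    N M _  =
    trans (sumF-*ʳ 0 c) (trans (*-zeroʳ (sumF c)) (sym (*-zeroʳ b)))
  digitSqSum-balance {m} c {b} Σc≡b bn<d (suc K) N M eq = begin
    sumF (λ j → c j * (x j * x j + digitSqSum K (N' j)))
      ≡⟨ sumF-cong _ _ (λ j → *-distribˡ-+ (c j) (x j * x j) _) ⟩
    sumF (λ j → c j * (x j * x j) + c j * digitSqSum K (N' j))
      ≡⟨ sumF-+ (λ j → c j * (x j * x j)) _ ⟩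
    sumF (λ j → c j * (x j * x j)) + sumF (λ j → c j * digitSqSum K (N' j))
      ≡⟨ cong₂ _+_ (sumF-sq-decomposition c x y Σc≡b (proj₁ split))
                   (digitSqSum-balance c Σc≡b bn<d K N' M' (proj₂ split)) ⟩
    (sqDeviation c x y + b * (y * y)) + (deviation K c N' M' + b * digitSqSum K M')
      ≡⟨ regroup (sqDeviation c x y) (deviation K c N' M') b (y * y) _ ⟩
    deviation (suc K) c N M + b * digitSqSum (suc K) M ∎
    where
    open ≡-Reasoning
    regroup : ∀ s t b u v → (s + b * u) + (t + b * v) ≡ (s + t) + b * (u + v)
    regroup = solve-∀
    x N' : Fin m → ℕ
    x = lastDigit ∘ N
    N' = dropDigit ∘ N
    y M' : ℕ
    y = lastDigit M
    M' = dropDigit M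
    split : sumF (λ j → c j * x j) ≡ b * y × sumF (λ j → c j * rebase K (N' j)) ≡ b * rebase K M'
    split = sumF-digit-split c x (λ j → rebase K (N' j)) Σc≡b (lastDigit≤ ∘ N) (lastDigit≤ M) bn<d eq

module Construction (n d : ℕ) (n<d : n < d) (K : ℕ) where
  open Digits n d

  W : ℕ
  W = suc (n * n)

  sqClass : ℕ → ℕ
  sqClass N = digitSqSum K N / W

  sqResidue : ℕ → ℕ
  sqResidue N = digitSqSum K N % W

  code : ℕ → ℕ
  code N = sqResidue N + d * d * rebase K N

  codeMax : ℕ
  codeMax = n * n + d * d * rebaseMax K

  sqClass< : ∀ N → sqClass N < suc K
  sqClass< N = m<n*o⇒m/o<n (begin-strict
    digitSqSum K N ≤⟨ digitSqSum≤ K N ⟩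
    K * (n * n)    ≤⟨ *-monoʳ-≤ K (n≤1+n (n * n)) ⟩
    K * W          <⟨ m<n+m (K * W) z<s ⟩
    W + K * W      ∎)
    where open ≤-Reasoning

  largestClass : ∃[ i ] length (upTo (suc n ^ K)) ≤ suc K * length (fibre sqClass i (upTo (suc n ^ K)))
  largestClass = pigeonhole sqClass (suc K) (upTo (suc n ^ K)) (All.tabulate (λ {N} _ → sqClass< N))

  chosenClass : ℕ
  chosenClass = proj₁ largestClass

  members : List ℕ
  members = fibre sqClass chosenClass (upTo (suc n ^ K))

  S : List ℕ
  S = map code members

  member⁻ : ∀ {N} → N ∈ members → N ∈ upTo (suc n ^ K) × sqClass N ≡ chosenClass
  member⁻ = ∈-filter⁻ (λ N → sqClass N ≟ chosenClass) {xs = upTo (suc n ^ K)}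

  member< : ∀ {N} → N ∈ members → N < suc n ^ K
  member< = ∈-upTo⁻ ∘ proj₁ ∘ member⁻

  digitSqSum-member : ∀ {N} → N ∈ members → digitSqSum K N ≡ sqResidue N + W * chosenClass
  digitSqSum-member {N} N∈ = begin
    digitSqSum K N                ≡⟨ m≡m%n+[m/n]*n (digitSqSum K N) W ⟩
    sqResidue N + sqClass N * W   ≡⟨ cong (λ i → sqResidue N + i * W) (proj₂ (member⁻ N∈)) ⟩
    sqResidue N + chosenClass * W ≡⟨ cong (sqResidue N +_) (*-comm chosenClass W) ⟩
    sqResidue N + W * chosenClass ∎
    where open ≡-Reasoning

  sqResidue≤ : ∀ N → sqResidue N ≤ n * n
  sqResidue≤ N = s≤s⁻¹ (m%n<n (digitSqSum K N) W)

  code≤codeMax : ∀ N → code N ≤ codeMax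
  code≤codeMax N = +-mono-≤ (sqResidue≤ N) (*-monoʳ-≤ (d * d) (rebase≤rebaseMax K N))

  *-n*n< : ∀ {b} → b * n < d → b * (n * n) < d * d
  *-n*n< {b} bn<d = subst (_< d * d) (*-assoc b n n) (*-mono-< bn<d n<d)

  *-codeMax< : ∀ {b} → b * n < d → b * codeMax < d ^ (2 + K)
  *-codeMax< {b} bn<d = subst (b * codeMax <_) (*-assoc d d (d ^ K))
    (*-+-*-< {b} (*-n*n< {b} bn<d) (*-rebaseMax< {b} bn<d K))

  code-injective : ∀ {N N'} → N ∈ members → N' ∈ members → code N ≡ code N' → N ≡ N'
  code-injective N∈ N'∈ eq = rebase-injective n<d K (member< N∈) (member< N'∈)
    (proj₂ (+-*-injective residue<d² residue<d² eq))
    where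
    residue<d² : ∀ {N} → sqResidue N < d * d
    residue<d² {N} = ≤-<-trans (sqResidue≤ N) (*-mono-< n<d n<d)

  S-unique : Unique S
  S-unique = Unique-map⁺-on code code-injective (filter⁺ _ (upTo⁺ (suc n ^ K)))

  S-large : suc n ^ K ≤ suc K * length S
  S-large = begin
    suc n ^ K                       ≡⟨ length-upTo (suc n ^ K) ⟨
    length (upTo (suc n ^ K))       ≤⟨ proj₂ largestClass ⟩
    suc K * length members          ≡⟨ cong (suc K *_) (length-map code members) ⟨
    suc K * length S                ∎
    where open ≤-Reasoning

  S≤codeMax : ∀ {x} → x ∈ S → x ≤ codeMax
  S≤codeMax x∈S with N , _ , refl ← ∈-map⁻ code x∈S = code≤codeMax N

  module _ {m} (c : Fin m → ℕ) {b} (Σc≡b : sumF c ≡ b) (bn<d : b * n < d) where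

    members-rigid : ∀ (N : Fin m → ℕ) {M} → (∀ j → N j ∈ members) → M ∈ members →
      sumF (λ j → c j * code (N j)) ≡ b * code M → ∀ j → c j ≢ 0 → N j ≡ M
    members-rigid N {M} N∈ M∈ balanced j cj≢0 =
      rebase-injective n<d K (member< (N∈ j)) (member< M∈)
        (deviation≡0⇒rebase≡ K c N M no-deviation j cj≢0)
      where
      open ≡-Reasoning
      i : ℕ
      i = chosenClass
      split : sumF (λ j → c j * sqResidue (N j)) ≡ b * sqResidue M ×
              sumF (λ j → c j * rebase K (N j)) ≡ b * rebase K M
      split = sumF-digit-split c (sqResidue ∘ N) (rebase K ∘ N) Σc≡b (sqResidue≤ ∘ N) (sqResidue≤ M)
                (*-n*n< {b} bn<d) balanced
      sq-balanced : sumF (λ j → c j * digitSqSum K (N j)) ≡ b * digitSqSum K M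
      sq-balanced = begin
        sumF (λ j → c j * digitSqSum K (N j))
          ≡⟨ sumF-cong _ _ (λ j → cong (c j *_) (digitSqSum-member (N∈ j))) ⟩
        sumF (λ j → c j * (sqResidue (N j) + W * i))
          ≡⟨ sumF-*-+-* c (sqResidue ∘ N) (λ _ → i) W ⟩
        sumF (λ j → c j * sqResidue (N j)) + W * sumF (λ j → c j * i)
          ≡⟨ cong₂ (λ s t → s + W * t) (proj₁ split) (trans (sumF-*ʳ i c) (cong (_* i) Σc≡b)) ⟩
        b * sqResidue M + W * (b * i)
          ≡⟨ scale-digits b (sqResidue M) W i ⟨
        b * (sqResidue M + W * i)
          ≡⟨ cong (b *_) (digitSqSum-member M∈) ⟨
        b * digitSqSum K M ∎
      no-deviation : deviation K c N M ≡ 0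
      no-deviation = +-cancelʳ-≡ _ _ 0
        (trans (sym (digitSqSum-balance c Σc≡b bn<d K N M (proj₂ split))) sq-balanced)

    S-solution-free : ∀ {q} → d ^ (2 + K) ≤ q → ∀ j₀ → c j₀ ≢ 0 → ¬ ProperSolution q c b S
    S-solution-free {q} dᴷ⁺²≤q j₀ cj₀≢0 (u , v , u∈S , v∈S , _ , u≢v , u≡v[mod]) =
      u≢v j₀ (begin
        u j₀        ≡⟨ u≡code j₀ ⟩
        code (N j₀) ≡⟨ cong code (members-rigid N N∈ M∈ balanced j₀ cj₀≢0) ⟩
        code M      ≡⟨ v≡code ⟨
        v           ∎)
      where
      open ≡-Reasoning
      N : Fin m → ℕ
      N j = proj₁ (∈-map⁻ code (u∈S j))
      N∈ : ∀ j → N j ∈ members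
      N∈ j = proj₁ (proj₂ (∈-map⁻ code (u∈S j)))
      u≡code : ∀ j → u j ≡ code (N j)
      u≡code j = proj₂ (proj₂ (∈-map⁻ code (u∈S j)))
      M : ℕ
      M = proj₁ (∈-map⁻ code v∈S)
      M∈ : M ∈ members
      M∈ = proj₁ (proj₂ (∈-map⁻ code v∈S))
      v≡code : v ≡ code M
      v≡code = proj₂ (proj₂ (∈-map⁻ code v∈S))
      b*codeMax<q : b * codeMax < q
      b*codeMax<q = <-≤-trans (*-codeMax< {b} bn<d) dᴷ⁺²≤q
      Σcu<q : sumF (λ j → c j * u j) < q
      Σcu<q = ≤-<-trans
        (subst (λ s → sumF (λ j → c j * u j) ≤ s * codeMax) Σc≡b (sumF-*-≤ c u (S≤codeMax ∘ u∈S)))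
        b*codeMax<q
      bv<q : b * v < q
      bv<q = ≤-<-trans (*-monoʳ-≤ b (S≤codeMax v∈S)) b*codeMax<q
      balanced : sumF (λ j → c j * code (N j)) ≡ b * code M
      balanced = begin
        sumF (λ j → c j * code (N j)) ≡⟨ sumF-cong _ _ (λ j → cong (c j *_) (u≡code j)) ⟨
        sumF (λ j → c j * u j)        ≡⟨ ≡[mod]⇒≡ u≡v[mod] Σcu<q bv<q ⟩
        b * v                         ≡⟨ cong (b *_) v≡code ⟩
        b * code M                    ∎

  S-below : ∀ {q} → d ^ (2 + K) ≤ q → All (_< q) S
  S-below dᴷ⁺²≤q = All.tabulate (λ x∈S → <-≤-trans (≤-<-trans (S≤codeMax x∈S) codeMax<) dᴷ⁺²≤q)
    where
    codeMax< : codeMax < d ^ (2 + K)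
    codeMax< = subst (_< d ^ (2 + K)) (*-identityˡ codeMax)
      (*-codeMax< {1} (subst (_< d) (sym (*-identityˡ n)) n<d))

¬ProperSolution-[] : ∀ {q m} (c : Fin m → ℕ) b → ¬ ProperSolution q c b []
¬ProperSolution-[] _ _ (_ , _ , _ , () , _)

n<1+n*D : ∀ n D {q k} → D < q → q < suc (n * D) ^ k → n < suc (n * D)
n<1+n*D n zero    {q} {k} 0<q q<dᵏ rewrite *-zeroʳ n | ^-zeroˡ k =
  ⊥-elim (<-irrefl refl (<-≤-trans 0<q (s≤s⁻¹ q<dᵏ)))
n<1+n*D n (suc D) _ _ = s≤s (m≤m*n n (suc D))

-- Only one nonzero coefficient per equation is needed, and neither 0 < b i nor the bounds on n are.
lemma3 : (ℓ m : ℕ) (c : Fin ℓ → Fin m → ℕ) (b : Fin ℓ → ℕ) →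
         (∀ i → Σ (Fin m) λ j → Σ (Fin m) λ j' → j ≢ j' × c i j ≢ 0 × c i j' ≢ 0) →
         (∀ i → sumF (c i) ≡ b i) →
         (∀ i → 0 < b i) →
         (q n : ℕ) → maxF b < q → 0 < n → n * maxF b < q →
         (k : ℕ) → (suc (n * maxF b)) ^ k ≤ q → q < (suc (n * maxF b)) ^ (suc k) →
         Σ (List ℕ) λ S → SubsetOfRange q S ×
           (suc n) ^ (k ∸ 2) ≤ k * length S + 1 ×
           (∀ i → ¬ ProperSolution q (c i) (b i) S)
lemma3 _ _ c b _ _ _ _ _ _ _ _ 0 _ _ = [] , ([] , []) , ≤-refl , λ i → ¬ProperSolution-[] (c i) (b i)
lemma3 _ _ c b _ _ _ _ _ _ _ _ 1 _ _ = [] , ([] , []) , ≤-refl , λ i → ¬ProperSolution-[] (c i) (b i)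
lemma3 _ _ c b nonzero Σc≡b _ q n D<q _ _ (suc (suc K)) dᴷ⁺²≤q q<dᴷ⁺³ =
  S , (S-unique , S-below dᴷ⁺²≤q) , large , solution-free
  where
  D d : ℕ
  D = maxF b
  d = suc (n * D)
  open Construction n d (n<1+n*D n D {k = 3 + K} D<q q<dᴷ⁺³) K
  bn<d : ∀ i → b i * n < d
  bn<d i = s≤s (subst (_≤ n * D) (*-comm n (b i)) (*-monoʳ-≤ n (≤-maxF b i)))
  large : suc n ^ K ≤ suc (suc K) * length S + 1
  large = ≤-trans S-large (≤-trans (*-monoˡ-≤ (length S) (n≤1+n (suc K))) (m≤m+n _ 1))
  solution-free : ∀ i → ¬ ProperSolution q (c i) (b i) S
  solution-free i with j , _ , _ , cij≢0 , _ ← nonzero i =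
    S-solution-free (c i) (Σc≡b i) (bn<d i) dᴷ⁺²≤q j cij≢0
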